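{- Let $m,n,s,k,\lambda,t$ be positive integers with $t$ dividing $\frac{2nk}{\lambda}$. If $\lambda\equiv 2\pmod 4$, $v=\frac{2nk}{\lambda}+t\equiv 2\pmod 4$ and $t$ is odd, then no ${}^{\lambda}\mathrm{H}_t(m,n;s,k)$ exists.
   Context: A partially filled (p.f.) $m\times n$ array is an $m\times n$ matrix in which some cells may be empty. With $v=\frac{2nk}{\lambda}+t$ and $J$ the subgroup of $\mathbb{Z}_v$ of order $t$, a $\lambda$-fold Heffter array over $\mathbb{Z}_v$ relative to $J$, denoted ${}^{\lambda}\mathrm{H}_t(m,n;s,k)$, is an $m\times n$ p.f. array with entries in $\mathbb{Z}_v$ such that: (a) each row has exactly $s$ filled cells and each column exactly $k$ filled cells; (b) the multiset $\{\pm x : x \text{ an entry of a filled cell}\}$ (with multiplicity over all filled cells) contains each element of $\mathbb{Z}_v\setminus J$ exactly $\lambda$ times; (c) the entries of every row and every column sum to $0$ in $\mathbb{Z}_v$. -}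

module Defs where

open import Data.Nat using (ℕ; zero; suc; _+_; _*_)
open import Data.Nat.Divisibility using (_∣_; _∣?_)
open import Data.Fin using (Fin; toℕ)
import Data.Fin as Fin
open import Data.Maybe using (Maybe; just; nothing)
open import Data.Bool using (Bool; true; false; if_then_else_)
open import Data.Product using (Σ; _×_)
open import Relation.Nullary.Decidable using (⌊_⌋)
open import Relation.Binary.PropositionalEquality using (_≡_)
open import Relation.Nullary using (¬_)
import Data.Nat

Σ< : (n : ℕ) → (Fin n → ℕ) → ℕ
Σ< zero    f = 0
Σ< (suc n) f = f Fin.zero + Σ< n (λ i → f (Fin.suc i))

[_] : Bool → ℕ
[ true ]  = 1
[ false ] = 0

-- A partially filled m × n array with entries in ℤ_v
-- (ℤ_v is represented by Fin v, with arithmetic modulo v; an empty cell is 'nothing').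
PFArray : ℕ → ℕ → ℕ → Set
PFArray m n v = Fin m → Fin n → Maybe (Fin v)

filled : ∀ {v} → Maybe (Fin v) → ℕ
filled (just _) = 1
filled nothing  = 0

val : ∀ {v} → Maybe (Fin v) → ℕ
val (just x) = toℕ x
val nothing  = 0

-- number of times y ∈ ℤ_v occurs in the multiset {x, -x} for the cell entry x
-- (x = y in ℤ_v iff toℕ x ≡ toℕ y; -x = y in ℤ_v iff v ∣ x + y)
occ : ∀ {v} → Fin v → Maybe (Fin v) → ℕ
occ {v} y (just x) = [ ⌊ toℕ x Data.Nat.≟ toℕ y ⌋ ] + [ ⌊ v ∣? (toℕ x + toℕ y) ⌋ ]
occ     y nothing  = 0

-- J : the subgroup of ℤ_v of order t (t ∣ v), i.e. { y : t·y = 0 in ℤ_v }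
InJ : (v t : ℕ) → Fin v → Set
InJ v t y = v ∣ t * toℕ y

mult : ∀ {m n v} → PFArray m n v → Fin v → ℕ
mult {m} {n} A y = Σ< m (λ i → Σ< n (λ j → occ y (A i j)))

-- λ-fold Heffter array  ^λH_t(m,n;s,k)  over ℤ_v, v = N + t, where N = 2nk/λ.
record IsHeffter (lam m n s k t v : ℕ) (A : PFArray m n v) : Set where
  field
    rowFilled : ∀ i → Σ< n (λ j → filled (A i j)) ≡ s
    colFilled : ∀ j → Σ< m (λ i → filled (A i j)) ≡ k
    multOutJ  : ∀ y → ¬ InJ v t y → mult A y ≡ lam
    multInJ   : ∀ y → InJ v t y → mult A y ≡ 0
    rowSum    : ∀ i → v ∣ Σ< n (λ j → val (A i j))
    colSum    : ∀ j → v ∣ Σ< m (λ i → val (A i j))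

HeffterArray : (lam m n s k t N : ℕ) → Set
HeffterArray lam m n s k t N = Σ (PFArray m n (N + t)) (IsHeffter lam m n s k t (N + t))

-- Weight each y ∈ ℤ_v by its parity y mod 2, which is meaningful because v is even.
-- As t is odd, no odd y lies in J, so each of the v/2 odd elements occurs λ times among
-- the ±entries; as x and −x have the same parity, the array then has exactly λv/4 odd
-- entries, an odd number because λ ≡ v ≡ 2 (mod 4). But every row sums to a multiple of
-- the even number v, hence has an even number of odd entries.
module Submission where

open import Defs
open import Data.Nat using (ℕ; zero; suc; _+_; _*_; _∸_; _<_; _≤_; _%_; _/_; NonZero)
open import Data.Nat.Divisibility using (_∣_; _∣?_; _∣0; ∣⇒≤; ∣-trans; ∣m∣n⇒∣m+n; ∣m+n∣m⇒∣n; n∣m⇒m%n≡0; m%n≡0⇒n∣m; divides)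
open import Data.Nat.DivMod using (_mod_; m≡m%n+[m/n]*n; [m+kn]%n≡m%n; %-distribˡ-+; %-distribˡ-*; m%n%n≡m%n; n%n≡0)
open import Data.Nat.Properties
open import Data.Nat.Tactic.RingSolver using (solve-∀)
open import Data.Fin using (Fin; toℕ; punchIn)
open import Data.Fin.Properties using (toℕ<n; toℕ-injective; toℕ-fromℕ<; punchInᵢ≢i)
open import Data.Maybe using (Maybe; just; nothing)
open import Data.Product using (Σ; _×_; _,_)
open import Data.Sum using (_⊎_; inj₁; inj₂)
open import Function using (_∘_)
open import Relation.Binary.PropositionalEquality using (_≡_; _≢_; refl; sym; trans; cong; cong₂; subst; module ≡-Reasoning)
open import Relation.Nullary using (¬_; yes; no; contradiction)
open import Relation.Nullary.Decidable using (⌊_⌋)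
open import Relation.Unary using (Decidable)
open import Algebra.Properties.CommutativeMonoid.Sum +-0-commutativeMonoid using (sum; sum-cong-≗; sum-remove; sum-replicate-zero; ∑-distrib-+; ∑-comm)
open import Algebra.Properties.Semiring.Sum +-*-semiring using (*-distribˡ-sum; *-distribʳ-sum)

open ≡-Reasoning

Σ<≡sum : ∀ n (f : Fin n → ℕ) → Σ< n f ≡ sum f
Σ<≡sum zero    f = refl
Σ<≡sum (suc n) f = cong (f Fin.zero +_) (Σ<≡sum n (f ∘ Fin.suc))

sum-zero : ∀ {n} (f : Fin n → ℕ) → (∀ i → f i ≡ 0) → sum f ≡ 0
sum-zero {n} _ f≡0 = trans (sum-cong-≗ f≡0) (sum-replicate-zero n)

sum-single : ∀ {n} (f : Fin n → ℕ) (i : Fin n) → (∀ j → j ≢ i → f j ≡ 0) → sum f ≡ f i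
sum-single {suc n} f i f≡0 = begin
  sum f                             ≡⟨ sum-remove {i = i} f ⟩
  f i + sum (λ j → f (punchIn i j)) ≡⟨ cong (f i +_) (sum-zero _ (λ j → f≡0 _ (punchInᵢ≢i i j))) ⟩
  f i + 0                           ≡⟨ +-identityʳ (f i) ⟩
  f i                               ∎

sum-indicator : ∀ {n} {P : Fin n → Set} (P? : Decidable P) (g : Fin n → ℕ) {i} →
                P i → (∀ {j} → P j → j ≡ i) → sum (λ j → g j * [ ⌊ P? j ⌋ ]) ≡ g i
sum-indicator P? g {i} Pi unique = trans (sum-single _ i vanish) at-i
  where
  vanish : ∀ j → j ≢ i → g j * [ ⌊ P? j ⌋ ] ≡ 0
  vanish j j≢i with P? j
  ... | yes Pj = contradiction (unique Pj) j≢i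
  ... | no _   = *-zeroʳ (g j)
  at-i : g i * [ ⌊ P? i ⌋ ] ≡ g i
  at-i with P? i
  ... | yes _  = *-identityʳ (g i)
  ... | no ¬Pi = contradiction Pi ¬Pi

sum-%-distrib : ∀ d .{{_ : NonZero d}} {n} (f : Fin n → ℕ) → sum (λ i → f i % d) % d ≡ sum f % d
sum-%-distrib d f = begin
  sum (λ i → f i % d) % d                           ≡⟨ [m+kn]%n≡m%n _ (sum (λ i → f i / d)) d ⟨
  (sum (λ i → f i % d) + sum (λ i → f i / d) * d) % d ≡⟨ cong (λ s → (sum (λ i → f i % d) + s) % d) (*-distribʳ-sum d (λ i → f i / d)) ⟩
  (sum (λ i → f i % d) + sum (λ i → f i / d * d)) % d ≡⟨ cong (_% d) (∑-distrib-+ (λ i → f i % d) (λ i → f i / d * d)) ⟨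
  sum (λ i → f i % d + f i / d * d) % d             ≡⟨ cong (_% d) (sum-cong-≗ (λ i → m≡m%n+[m/n]*n (f i) d)) ⟨
  sum f % d                                         ∎

∣-sum : ∀ {d n} {f : Fin n → ℕ} → (∀ i → d ∣ f i) → d ∣ sum f
∣-sum {d} {zero}  d∣f = d ∣0
∣-sum {d} {suc n} d∣f = ∣m∣n⇒∣m+n (d∣f Fin.zero) (∣-sum (d∣f ∘ Fin.suc))

%2-cong : ∀ a b → (a + b) % 2 ≡ 0 → a % 2 ≡ b % 2
%2-cong 0             b             a+b-even = sym a+b-even
%2-cong 1             0             ()
%2-cong 1             1             _        = refl
%2-cong 1             (suc (suc b)) a+b-even = %2-cong 1 b a+b-even
%2-cong (suc (suc a)) b             a+b-even = %2-cong a b a+b-even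

%2-split : ∀ a → a % 2 ≡ 0 ⊎ a % 2 ≡ 1
%2-split 0             = inj₁ refl
%2-split 1             = inj₂ refl
%2-split (suc (suc a)) = %2-split a

*-odd : ∀ a b → a % 2 ≡ 1 → b % 2 ≡ 1 → (a * b) % 2 ≡ 1
*-odd a b a-odd b-odd = trans (%-distribˡ-* a b 2) (cong₂ (λ r s → (r * s) % 2) a-odd b-odd)

%4≡2⇒odd*2 : ∀ {a} → a % 4 ≡ 2 → Σ ℕ (λ b → a ≡ b * 2 × b % 2 ≡ 1)
%4≡2⇒odd*2 {a} a%4≡2 = 1 + a / 4 * 2 , a≡[1+q*2]*2 , [m+kn]%n≡m%n 1 (a / 4) 2
  where
  2+q*4≡[1+q*2]*2 : ∀ q → 2 + q * 4 ≡ (1 + q * 2) * 2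
  2+q*4≡[1+q*2]*2 = solve-∀
  a≡[1+q*2]*2 : a ≡ (1 + a / 4 * 2) * 2
  a≡[1+q*2]*2 = trans (m≡m%n+[m/n]*n a 4) (trans (cong (_+ a / 4 * 4) a%4≡2) (2+q*4≡[1+q*2]*2 (a / 4)))

odd⇒∤2 : ∀ {a} → a % 2 ≡ 1 → ¬ 2 ∣ a
odd⇒∤2 {a} a-odd 2∣a with () ← trans (sym (n∣m⇒m%n≡0 a 2 2∣a)) a-odd

-- (2 + i) % 2 reduces to i % 2, so both clauses hold definitionally.
sum-parity : ∀ a → sum {a * 2} (λ i → toℕ i % 2) ≡ a
sum-parity zero    = refl
sum-parity (suc a) = cong suc (sum-parity a)

-- The outer mod sends −0 = v back to 0.
negate : ∀ {v} → Fin v → Fin v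
negate {v@(suc _)} x = (v ∸ toℕ x) mod v

∣-+-negate : ∀ {v} (x : Fin v) → v ∣ toℕ x + toℕ (negate x)
∣-+-negate {v@(suc _)} x = m%n≡0⇒n∣m _ v (begin
  (toℕ x + toℕ ((v ∸ toℕ x) mod v)) % v ≡⟨ cong (λ y → (toℕ x + y) % v) (toℕ-fromℕ< _) ⟩
  (toℕ x + (v ∸ toℕ x) % v) % v         ≡⟨ %-distribˡ-+ (toℕ x) _ v ⟩
  (toℕ x % v + (v ∸ toℕ x) % v % v) % v ≡⟨ cong (λ y → (toℕ x % v + y) % v) (m%n%n≡m%n (v ∸ toℕ x) v) ⟩
  (toℕ x % v + (v ∸ toℕ x) % v) % v     ≡⟨ %-distribˡ-+ (toℕ x) _ v ⟨
  (toℕ x + (v ∸ toℕ x)) % v             ≡⟨ cong (_% v) (m+[n∸m]≡n (<⇒≤ (toℕ<n x))) ⟩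
  v % v                                 ≡⟨ n%n≡0 v ⟩
  0                                     ∎)

∣∧<⇒≡0 : ∀ {d n} → d ∣ n → n < d → n ≡ 0
∣∧<⇒≡0 {n = zero}  _   _   = refl
∣∧<⇒≡0 {n = suc _} d∣n n<d = contradiction (∣⇒≤ d∣n) (<⇒≱ n<d)

∣-+-cancelˡ-≤ : ∀ {v x y z} → y ≤ z → z < v → v ∣ x + y → v ∣ x + z → y ≡ z
∣-+-cancelˡ-≤ {v} {x} {y} {z} y≤z z<v v∣x+y v∣x+z =
  ≤-antisym y≤z (m∸n≡0⇒m≤n (∣∧<⇒≡0 v∣z∸y (≤-<-trans (m∸n≤m z y) z<v)))
  where
  x+z≡x+y+[z∸y] : x + z ≡ x + y + (z ∸ y)
  x+z≡x+y+[z∸y] = trans (cong (x +_) (sym (m+[n∸m]≡n y≤z))) (sym (+-assoc x y _))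
  v∣z∸y : v ∣ z ∸ y
  v∣z∸y = ∣m+n∣m⇒∣n (subst (v ∣_) x+z≡x+y+[z∸y] v∣x+z) v∣x+y

∣-+-cancelˡ : ∀ {v x y z} → y < v → z < v → v ∣ x + y → v ∣ x + z → y ≡ z
∣-+-cancelˡ {y = y} {z} y<v z<v v∣x+y v∣x+z with ≤-total y z
... | inj₁ y≤z = ∣-+-cancelˡ-≤ y≤z z<v v∣x+y v∣x+z
... | inj₂ z≤y = sym (∣-+-cancelˡ-≤ z≤y y<v v∣x+z v∣x+y)

odd∉J : ∀ {v t} → 2 ∣ v → t % 2 ≡ 1 → (y : Fin v) → toℕ y % 2 ≡ 1 → ¬ InJ v t y
odd∉J {t = t} 2∣v t-odd y y-odd v∣ty = odd⇒∤2 (*-odd t (toℕ y) t-odd y-odd) (∣-trans 2∣v v∣ty)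

parity-occ : ∀ {v} → 2 ∣ v → (c : Maybe (Fin v)) → sum (λ y → toℕ y % 2 * occ y c) ≡ 2 * (val c % 2)
parity-occ {v} 2∣v nothing = sum-zero {v} _ (λ y → *-zeroʳ (toℕ y % 2))
parity-occ {v} 2∣v (just x) = begin
  sum (λ y → w y * occ y (just x))
    ≡⟨ sum-cong-≗ (λ y → *-distribˡ-+ (w y) _ _) ⟩
  sum (λ y → w y * [ ⌊ toℕ x ≟ toℕ y ⌋ ] + w y * [ ⌊ v ∣? toℕ x + toℕ y ⌋ ])
    ≡⟨ ∑-distrib-+ (λ y → w y * [ ⌊ toℕ x ≟ toℕ y ⌋ ]) (λ y → w y * [ ⌊ v ∣? toℕ x + toℕ y ⌋ ]) ⟩
  sum (λ y → w y * [ ⌊ toℕ x ≟ toℕ y ⌋ ]) + sum (λ y → w y * [ ⌊ v ∣? toℕ x + toℕ y ⌋ ])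
    ≡⟨ cong₂ _+_ (sum-indicator (λ y → toℕ x ≟ toℕ y) w refl (toℕ-injective ∘ sym))
                 (sum-indicator (λ y → v ∣? toℕ x + toℕ y) w (∣-+-negate x) negate-unique) ⟩
  w x + w (negate x)
    ≡⟨ cong (w x +_) (%2-cong (toℕ x) (toℕ (negate x)) (n∣m⇒m%n≡0 _ 2 (∣-trans 2∣v (∣-+-negate x)))) ⟨
  w x + w x
    ≡⟨ cong (w x +_) (+-identityʳ (w x)) ⟨
  2 * w x
    ∎
  where
  w : Fin v → ℕ
  w y = toℕ y % 2
  negate-unique : ∀ {y} → v ∣ toℕ x + toℕ y → y ≡ negate x
  negate-unique v∣x+y = toℕ-injective (∣-+-cancelˡ (toℕ<n _) (toℕ<n _) v∣x+y (∣-+-negate x))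

oddEntryCount : ∀ {m n v} → PFArray m n v → ℕ
oddEntryCount A = sum (λ i → sum (λ j → val (A i j) % 2))

mult≡sum : ∀ {m n v} (A : PFArray m n v) (y : Fin v) → mult A y ≡ sum (λ i → sum (λ j → occ y (A i j)))
mult≡sum {m} {n} A y =
  trans (Σ<≡sum m (λ i → Σ< n (λ j → occ y (A i j)))) (sum-cong-≗ (λ i → Σ<≡sum n (λ j → occ y (A i j))))

sum-parity*mult : ∀ {m n v} → 2 ∣ v → (A : PFArray m n v) →
                  sum (λ y → toℕ y % 2 * mult A y) ≡ 2 * oddEntryCount A
sum-parity*mult {m} {n} {v} 2∣v A = begin
  sum (λ y → w y * mult A y)
    ≡⟨ sum-cong-≗ (λ y → cong (w y *_) (mult≡sum A y)) ⟩
  sum (λ y → w y * sum (λ i → sum (λ j → occ y (A i j))))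
    ≡⟨ sum-cong-≗ (λ y → trans (*-distribˡ-sum (w y) (λ i → sum (λ j → occ y (A i j))))
                                 (sum-cong-≗ (λ i → *-distribˡ-sum (w y) (λ j → occ y (A i j))))) ⟩
  sum (λ y → sum (λ i → sum (λ j → w y * occ y (A i j))))
    ≡⟨ ∑-comm (λ y i → sum (λ j → w y * occ y (A i j))) ⟩
  sum (λ i → sum (λ y → sum (λ j → w y * occ y (A i j))))
    ≡⟨ sum-cong-≗ (λ i → ∑-comm (λ y j → w y * occ y (A i j))) ⟩
  sum (λ i → sum (λ j → sum (λ y → w y * occ y (A i j))))
    ≡⟨ sum-cong-≗ (λ i → sum-cong-≗ (λ j → parity-occ 2∣v (A i j))) ⟩
  sum (λ i → sum (λ j → 2 * (val (A i j) % 2)))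
    ≡⟨ sum-cong-≗ (λ i → *-distribˡ-sum 2 (λ j → val (A i j) % 2)) ⟨
  sum (λ i → 2 * sum (λ j → val (A i j) % 2))
    ≡⟨ *-distribˡ-sum 2 (λ i → sum (λ j → val (A i j) % 2)) ⟨
  2 * oddEntryCount A
    ∎
  where
  w : Fin v → ℕ
  w y = toℕ y % 2

oddEntryCount-even : ∀ {m n v} → 2 ∣ v → (A : PFArray m n v) →
                     (∀ i → v ∣ Σ< n (λ j → val (A i j))) → 2 ∣ oddEntryCount A
oddEntryCount-even {n = n} {v} 2∣v A rowSum = ∣-sum row-even
  where
  row-even : ∀ i → 2 ∣ sum (λ j → val (A i j) % 2)
  row-even i = m%n≡0⇒n∣m _ 2 (trans (sum-%-distrib 2 (λ j → val (A i j)))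
                 (n∣m⇒m%n≡0 _ 2 (∣-trans 2∣v (subst (v ∣_) (Σ<≡sum n (λ j → val (A i j))) (rowSum i)))))

heffter-oddEntryCount : ∀ {lam m n s k t v} a {A : PFArray m n v} → v ≡ a * 2 → t % 2 ≡ 1 →
                        IsHeffter lam m n s k t v A → 2 * oddEntryCount A ≡ a * lam
heffter-oddEntryCount {lam} {t = t} a {A} refl t-odd H = begin
  2 * oddEntryCount A       ≡⟨ sum-parity*mult 2∣v A ⟨
  sum (λ y → w y * mult A y) ≡⟨ sum-cong-≗ odd-mult ⟩
  sum (λ y → w y * lam)      ≡⟨ *-distribʳ-sum lam w ⟨
  sum w * lam                ≡⟨ cong (_* lam) (sum-parity a) ⟩
  a * lam                    ∎
  where
  w : Fin (a * 2) → ℕ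
  w y = toℕ y % 2
  2∣v : 2 ∣ a * 2
  2∣v = divides a refl
  odd-mult : ∀ y → w y * mult A y ≡ w y * lam
  odd-mult y with %2-split (toℕ y)
  ... | inj₁ y-even rewrite y-even = refl
  ... | inj₂ y-odd  = cong (w y *_) (IsHeffter.multOutJ H y (odd∉J {t = t} 2∣v t-odd y y-odd))

proposition4p2 : (m n s k lam t N : ℕ) → 0 < m → 0 < n → 0 < s → 0 < k → 0 < lam → 0 < t →
    lam * N ≡ 2 * n * k → t ∣ N →
    lam % 4 ≡ 2 → (N + t) % 4 ≡ 2 → t % 2 ≡ 1 →
    ¬ HeffterArray lam m n s k t N
proposition4p2 m n s k lam t N _ _ _ _ _ _ _ _ lam%4≡2 v%4≡2 t-odd (A , H)
  with l , lam≡l*2 , l-odd ← %4≡2⇒odd*2 lam%4≡2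
     | a , v≡a*2 , a-odd ← %4≡2⇒odd*2 v%4≡2
  = odd⇒∤2 (*-odd a l a-odd l-odd) (subst (2 ∣_) count≡a*l (oddEntryCount-even 2∣v A (IsHeffter.rowSum H)))
  where
  2∣v : 2 ∣ N + t
  2∣v = divides a v≡a*2
  count≡a*l : oddEntryCount A ≡ a * l
  count≡a*l = *-cancelˡ-≡ _ _ 2 (begin
    2 * oddEntryCount A ≡⟨ heffter-oddEntryCount a v≡a*2 t-odd H ⟩
    a * lam             ≡⟨ cong (a *_) lam≡l*2 ⟩
    a * (l * 2)         ≡⟨ *-assoc a l 2 ⟨
    a * l * 2           ≡⟨ *-comm (a * l) 2 ⟩
    2 * (a * l)         ∎)
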